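{- For any graph $X$ of order $n$: (1) $X\diamond X$ respects converse equivalence; (2) $X^2\approx (X\diamond X)+(X\diamond X)^{\mathsf T}$.
   Context: Labels are independent commuting indeterminates $x_0,x_1,\dots$; a graph of order $n$ is a symmetric $n\times n$ matrix of such labels; $X^2$ is computed in the commutative polynomial ring. For indeterminates $x,y$, $x\diamond y$ denotes a non-commutative formal product: $x\diamond y=x'\diamond y'$ iff $x=x'$ and $y=y'$. For matrices $X=(x_{ij}),Y=(y_{ij})$, $X\diamond Y$ is the matrix whose $(i,j)$ entry is the formal (commutative) sum $\sum_{k=1}^n x_{ik}\diamond y_{kj}$; two such sums are equal iff the multisets of their terms coincide. $M^{\mathsf T}$ is the transpose; entrywise sums of such matrices are formal sums. A matrix $Z=(z_{uv})$ respects converse equivalence if $z_{uv}=z_{rs}$ iff $z_{vu}=z_{sr}$. For matrices $M,N$ of the same order, $M\approx N$ means $m_{ij}=m_{st}\iff n_{ij}=n_{st}$ for all $i,j,s,t$. -}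

module Defs where

open import Data.Nat using (ℕ; _⊓_; _⊔_)
open import Data.Fin using (Fin)
open import Data.Product using (_×_; _,_)
open import Data.List using (List; map; allFin; _++_)
open import Data.List.Relation.Binary.Permutation.Propositional using (_↭_)
open import Function.Bundles using (_⇔_)
open import Relation.Binary.PropositionalEquality using (_≡_)

-- Labels: the indeterminate x_a is represented by its index a : ℕ.
Label : Set
Label = ℕ

Matrix : Set → ℕ → Set
Matrix A n = Fin n → Fin n → A

-- A graph of order n: a symmetric matrix of labels.
Symmetric : ∀ {n} → Matrix Label n → Set
Symmetric X = ∀ i j → X i j ≡ X j i

-- Formal (commutative) sums are multisets of terms: lists up to permutation (_↭_).

-- The non-commutative formal product x_a ◇ x_b is the ordered pair (a , b).
-- (X ◇ Y)_{ij} = Σ_k x_{ik} ◇ y_{kj}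
_◇_ : ∀ {n} → Matrix Label n → Matrix Label n → Matrix (List (Label × Label)) n
(_◇_ {n} X Y) i j = map (λ k → X i k , Y k j) (allFin n)

-- Commutative monomial x_a x_b, in canonical form (min , max).
mono : Label → Label → Label × Label
mono a b = (a ⊓ b , a ⊔ b)

-- X² in the commutative polynomial ring: the (i,j) entry Σ_k x_{ik} x_{kj} as the
-- multiset of its monomials (polynomials with ℕ coefficients = multisets of monomials).
square : ∀ {n} → Matrix Label n → Matrix (List (Label × Label)) n
square {n} X i j = map (λ k → mono (X i k) (X k j)) (allFin n)

_ᵀ : ∀ {A : Set} {n} → Matrix A n → Matrix A n
(M ᵀ) i j = M j i

_⊕_ : ∀ {A : Set} {n} → Matrix (List A) n → Matrix (List A) n → Matrix (List A) n
(M ⊕ N) i j = M i j ++ N i j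

RespectsConverse : ∀ {A : Set} {n} → Matrix (List A) n → Set
RespectsConverse Z = ∀ u v r s → (Z u v ↭ Z r s) ⇔ (Z v u ↭ Z s r)

_≈ᴹ_ : ∀ {A B : Set} {n} → Matrix (List A) n → Matrix (List B) n → Set
M ≈ᴹ N = ∀ i j s t → (M i j ↭ M s t) ⇔ (N i j ↭ N s t)

module Submission where

open import Defs
open import Data.Nat using (ℕ)
open import Data.Nat.Properties
  using (≤-total; ⊓-comm; ⊔-comm; m≤n⇒m⊓n≡m; m≤n⇒m⊔n≡n; m≥n⇒m⊓n≡n; m≥n⇒m⊔n≡m)
open import Data.Product using (_×_; _,_; swap; uncurry)
open import Data.Sum using (inj₁; inj₂; reduce)
open import Data.List using (List; []; _∷_; map; allFin; _++_)
open import Data.List.Properties using (map-∘; map-cong; map-++)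
open import Data.List.Relation.Unary.Any using (here)
open import Data.List.Membership.Propositional.Properties using (∈-++⁻; ∈-∃++)
open import Data.List.Relation.Binary.Permutation.Propositional
  using (_↭_; refl; prep; trans; ↭-sym; module PermutationReasoning)
  renaming (swap to ↭-swap)
open import Data.List.Relation.Binary.Permutation.Propositional.Properties
  using (map⁺; ++⁺; shift; drop-∷; ∈-resp-↭; ↭-empty-inv)
open import Function.Bundles using (_⇔_; mk⇔)
open import Relation.Binary.PropositionalEquality
  using (_≡_; refl; sym; cong; cong₂; subst₂)
  renaming (trans to ≡-trans)

-- As X is symmetric, the entry (X ◇ X)_vu is the entry (X ◇ X)_uv with
-- every formal product x ◇ y reversed to y ◇ x, which gives (1) at once. For (2), the
-- entry X²_ij is the image of (X ◇ X)_ij under x ◇ y ↦ xy, while the entry of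
-- (X ◇ X) + (X ◇ X)ᵀ is (X ◇ X)_ij together with all its reversals. The latter is the
-- multiset of both orientations of the monomials of X²_ij, so it determines X²_ij and
-- is determined by it; the first direction amounts to halving a doubled multiset.

module _ {A : Set} where

  ++-self-∷ : ∀ (x : A) xs → (x ∷ xs) ++ (x ∷ xs) ↭ x ∷ x ∷ (xs ++ xs)
  ++-self-∷ x xs = prep x (shift x xs xs)

  ++-self-cancel : ∀ (xs ys : List A) → xs ++ xs ↭ ys ++ ys → xs ↭ ys
  ++-self-cancel []       []       _ = refl
  ++-self-cancel []       (y ∷ ys) p with () ← ↭-empty-inv (↭-sym p)
  ++-self-cancel (x ∷ xs) ys       p
    with ys₁ , ys₂ , refl ← ∈-∃++ (reduce (∈-++⁻ ys (∈-resp-↭ p (here refl)))) =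
    trans (prep x (++-self-cancel xs (ys₁ ++ ys₂) (drop-∷ (drop-∷ p′))))
          (↭-sym (shift x ys₁ ys₂))
    where
    open PermutationReasoning
    p′ : x ∷ x ∷ (xs ++ xs) ↭ x ∷ x ∷ ((ys₁ ++ ys₂) ++ (ys₁ ++ ys₂))
    p′ = begin
      x ∷ x ∷ (xs ++ xs)                            ↭⟨ ↭-sym (++-self-∷ x xs) ⟩
      (x ∷ xs) ++ (x ∷ xs)                          ↭⟨ p ⟩
      (ys₁ ++ x ∷ ys₂) ++ (ys₁ ++ x ∷ ys₂)          ↭⟨ ++⁺ (shift x ys₁ ys₂) (shift x ys₁ ys₂) ⟩
      (x ∷ ys₁ ++ ys₂) ++ (x ∷ ys₁ ++ ys₂)          ↭⟨ ++-self-∷ x (ys₁ ++ ys₂) ⟩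
      x ∷ x ∷ ((ys₁ ++ ys₂) ++ (ys₁ ++ ys₂))        ∎

  orbit : A × A → List (A × A)
  orbit p = p ∷ swap p ∷ []

  withSwaps : List (A × A) → List (A × A)
  withSwaps ps = ps ++ map swap ps

  withSwaps-∷ : ∀ p ps → withSwaps (p ∷ ps) ↭ orbit p ++ withSwaps ps
  withSwaps-∷ p ps = prep p (shift (swap p) ps (map swap ps))

monomial : Label × Label → Label × Label
monomial = uncurry mono

monomial-swap : ∀ p → monomial (swap p) ≡ monomial p
monomial-swap (a , b) = cong₂ _,_ (⊓-comm b a) (⊔-comm b a)

orbit-monomial : ∀ p → orbit p ↭ orbit (monomial p)
orbit-monomial (a , b) with ≤-total a b
... | inj₁ a≤b rewrite m≤n⇒m⊓n≡m a≤b | m≤n⇒m⊔n≡n a≤b = refl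
... | inj₂ a≥b rewrite m≥n⇒m⊓n≡n a≥b | m≥n⇒m⊔n≡m a≥b = ↭-swap (a , b) (b , a) refl

withSwaps-monomial : ∀ ps → withSwaps ps ↭ withSwaps (map monomial ps)
withSwaps-monomial []       = refl
withSwaps-monomial (p ∷ ps) = begin
  withSwaps (p ∷ ps)                                   ↭⟨ withSwaps-∷ p ps ⟩
  orbit p ++ withSwaps ps                              ↭⟨ ++⁺ (orbit-monomial p) (withSwaps-monomial ps) ⟩
  orbit (monomial p) ++ withSwaps (map monomial ps)    ↭⟨ ↭-sym (withSwaps-∷ (monomial p) (map monomial ps)) ⟩
  withSwaps (map monomial (p ∷ ps))                    ∎
  where open PermutationReasoning

map-monomial-withSwaps : ∀ ps → map monomial (withSwaps ps) ≡ map monomial ps ++ map monomial ps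
map-monomial-withSwaps ps = ≡-trans (map-++ monomial ps (map swap ps))
  (cong (map monomial ps ++_) (≡-trans (sym (map-∘ ps)) (map-cong monomial-swap ps)))

map-monomial-↭⇔withSwaps-↭ : ∀ ps qs →
  (map monomial ps ↭ map monomial qs) ⇔ (withSwaps ps ↭ withSwaps qs)
map-monomial-↭⇔withSwaps-↭ ps qs = mk⇔ to from
  where
  to : map monomial ps ↭ map monomial qs → withSwaps ps ↭ withSwaps qs
  to m = trans (withSwaps-monomial ps)
           (trans (++⁺ m (map⁺ swap m)) (↭-sym (withSwaps-monomial qs)))
  from : withSwaps ps ↭ withSwaps qs → map monomial ps ↭ map monomial qs
  from w = ++-self-cancel _ _
    (subst₂ _↭_ (map-monomial-withSwaps ps) (map-monomial-withSwaps qs) (map⁺ monomial w))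

◇-transpose : ∀ {n} (X Y : Matrix Label n) u v → (X ◇ Y) v u ≡ map swap (((Y ᵀ) ◇ (X ᵀ)) u v)
◇-transpose {n} X Y u v = map-∘ (allFin n)

symmetric-◇-transpose : ∀ {n} {X : Matrix Label n} → Symmetric X →
  ∀ u v → (X ◇ X) v u ≡ map swap ((X ◇ X) u v)
symmetric-◇-transpose {n} {X} sym-X u v = ≡-trans (◇-transpose X X u v)
  (cong (map swap) (map-cong (λ k → cong₂ _,_ (sym-X k u) (sym-X v k)) (allFin n)))

square≡map-monomial-◇ : ∀ {n} (X : Matrix Label n) i j → square X i j ≡ map monomial ((X ◇ X) i j)
square≡map-monomial-◇ {n} X i j = map-∘ (allFin n)

proposition5 : (n : ℕ) (X : Matrix Label n) → Symmetric X →
    RespectsConverse (X ◇ X) × (square X ≈ᴹ ((X ◇ X) ⊕ ((X ◇ X) ᵀ)))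
proposition5 n X sym-X = respects-converse , square≈
  where
  Z : Matrix (List (Label × Label)) n
  Z = X ◇ X

  transpose-↭ : ∀ u v r s → Z u v ↭ Z r s → Z v u ↭ Z s r
  transpose-↭ u v r s p = subst₂ _↭_ (sym (symmetric-◇-transpose sym-X u v))
    (sym (symmetric-◇-transpose sym-X r s)) (map⁺ swap p)

  respects-converse : RespectsConverse Z
  respects-converse u v r s = mk⇔ (transpose-↭ u v r s) (transpose-↭ v u s r)

  ⊕≡withSwaps : ∀ i j → (Z ⊕ (Z ᵀ)) i j ≡ withSwaps (Z i j)
  ⊕≡withSwaps i j = cong (Z i j ++_) (symmetric-◇-transpose sym-X i j)

  square≈ : square X ≈ᴹ (Z ⊕ (Z ᵀ))
  square≈ i j s t
    rewrite square≡map-monomial-◇ X i j | square≡map-monomial-◇ X s t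
          | ⊕≡withSwaps i j | ⊕≡withSwaps s t = map-monomial-↭⇔withSwaps-↭ (Z i j) (Z s t)
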